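{- $\mathrm{ror}_{\mathrm{GFtP}}(\varepsilon)\ge 1+\varepsilon$. That is, for every $r<1$ there exists a WMST-instance $(G,\hat w,w)$ such that $$\frac{\mathbb{E}_\sigma[\mathrm{GFtP}(\hat w,w,\sigma)]}{\mathrm{Opt}(w)}\ge 1+r\varepsilon,$$ where $\sigma$ is a uniformly random arrival order of the true weights.
   Context: A WMST-instance is a triple $(G,\hat w,w)$ with $G=(V,E)$ a finite simple connected undirected graph, $n=|V|$, $m=|E|$, and $\hat w,w\colon E\to\mathbb{R}^+$ predicted and true edge weights. The algorithm knows $G$ and $\hat w$ in advance; the true weights arrive one by one as pairs $(w(e),e)$ in the order given by a uniformly random permutation $\sigma$ of $E$, and each edge must be irrevocably accepted or rejected upon arrival. $\mathrm{Opt}(w)$ is the minimum true weight of a spanning tree. Error: with $p_e=|w(e)-\hat w(e)|$, $\eta$ is the sum of the $n-1$ largest values among $\{p_e\}_{e\in E}$, and $\varepsilon=\eta/\mathrm{Opt}(w)$. Algorithm GFtP: initially $T$ is a minimum spanning tree w.r.t. $\hat w$ and $U=E$. Upon arrival of $(w(e_i),e_i)$: $U:=U\setminus\{e_i\}$; if $e_i\in T$ accept; otherwise let $C$ be the cycle $e_i$ creates in $T\cup\{e_i\}$ and $C'=U\cap C$; if $C'\ne\emptyset$ and $w(e_i)\le\hat w(e_{\max})$ where $e_{\max}$ is an edge of $C'$ of maximum $\hat w$, set $T:=(T\setminus\{e_{\max}\})\cup\{e_i\}$ and accept $e_i$; else reject. $\mathrm{GFtP}(\hat w,w,\sigma)$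 is the true weight of the final $T$.
   Formalization: The error ratio ε ranges only over the nonnegative rationals and r over the rationals, and the predicted and true edge weights of the witnessing instance are taken in the positive rationals. -}

module Defs where

open import Data.Nat.Base using (ℕ; zero; suc; _∸_)
open import Data.Fin.Base using (Fin; zero; suc)
open import Data.Fin.Subset using (Subset; ⊤; ⁅_⁆; _∪_; _∈_; _∉_) renaming (_-_ to _∖_)
open import Data.Vec.Base using (lookup)
open import Data.Bool.Base using (if_then_else_)
open import Data.List.Base using (List; []; _∷_; map; foldr; take; reverse; concatMap)
open import Data.List.Membership.Propositional using () renaming (_∈_ to _∈ₗ_)
open import Data.Fin.Base using () renaming (Fin to F)
open import Data.Product.Base using (Σ; Σ-syntax; _×_; _,_; proj₁; proj₂)
open import Data.Sum.Base using (_⊎_)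
open import Data.Empty using (⊥)
open import Function.Definitions using (Injective)
open import Relation.Binary.PropositionalEquality using (_≡_; _≢_)
open import Data.Rational.Base using (ℚ; 0ℚ; _+_; _-_; _≤_; _<_; ∣_∣)
open import Data.Rational.Properties using (≤-decTotalOrder)
import Data.List.Sort.MergeSort.Base as MS
import Data.Vec.Functional as VF

Joins : ∀ {n} → F n × F n → F n → F n → Set
Joins p u v = p ≡ (u , v) ⊎ p ≡ (v , u)

data Reachable {n m : ℕ} (ends : F m → F n × F n) (S : Subset m)
               : F n → F n → Set where
  here : ∀ {u} → Reachable ends S u u
  step : ∀ {u x v} (e : F m) → e ∈ S → Joins (ends e) u x →
         Reachable ends S x v → Reachable ends S u v

-- cyclic successor on Fin (suc k): i ↦ i+1, last ↦ 0
cyc : ∀ {k} → F (suc k) → F (suc k)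
cyc {zero}  _       = zero
cyc {suc k} zero    = suc zero
cyc {suc k} (suc i) with cyc {k} i
... | zero  = zero
... | suc j = suc (suc j)

record Cycle {n m : ℕ} (ends : F m → F n × F n) (S : Subset m) : Set where
  field
    k     : ℕ
    vs    : F (suc k) → F n
    es    : F (suc k) → F m
    vsInj : Injective _≡_ _≡_ vs
    esInj : Injective _≡_ _≡_ es
    esIn  : ∀ i → es i ∈ S
    esJ   : ∀ i → Joins (ends (es i)) (vs i) (vs (cyc i))

record Graph : Set where
  field
    n m    : ℕ
    ends   : F m → F n × F n
    noLoop : ∀ e → proj₁ (ends e) ≢ proj₂ (ends e)
    simple : ∀ e f → Joins (ends f) (proj₁ (ends e)) (proj₂ (ends e)) → e ≡ f
    connected : ∀ u v → Reachable ends ⊤ u v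

module _ (G : Graph) where
  open Graph G

  Acyclic : Subset m → Set
  Acyclic S = Cycle ends S → ⊥

  IsSpanningTree : Subset m → Set
  IsSpanningTree T = (∀ u v → Reachable ends T u v) × Acyclic T

  sumℚ : List ℚ → ℚ
  sumℚ = foldr _+_ 0ℚ

  weight : (F m → ℚ) → Subset m → ℚ
  weight c S = sumℚ (map (λ e → if lookup S e then c e else 0ℚ) (VF.toList (λ e → e)))

  IsMinST : (F m → ℚ) → Subset m → Set
  IsMinST c T = IsSpanningTree T × (∀ T' → IsSpanningTree T' → weight c T ≤ weight c T')

  OnCycle : Subset m → F m → F m → Set
  OnCycle T e f = Σ[ C ∈ Cycle ends (T ∪ ⁅ e ⁆) ] Σ[ i ∈ F (suc (Cycle.k C)) ] Cycle.es C i ≡ f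

  IsEmax : (F m → ℚ) → Subset m → Subset m → F m → F m → Set
  IsEmax ŵ T U e f = f ∈ U × OnCycle T e f ×
                     (∀ g → g ∈ U → OnCycle T e g → ŵ g ≤ ŵ f)

  data Step (ŵ w : F m → ℚ) : Subset m × Subset m → F m → Subset m × Subset m → Set where
    inTree  : ∀ {T U e} → e ∈ T → Step ŵ w (T , U) e (T , U ∖ e)
    swap    : ∀ {T U e} f → e ∉ T → IsEmax ŵ T (U ∖ e) e f → w e ≤ ŵ f →
              Step ŵ w (T , U) e ((T ∖ f) ∪ ⁅ e ⁆ , U ∖ e)
    rejEmpty : ∀ {T U e} → e ∉ T → (∀ g → g ∈ (U ∖ e) → OnCycle T e g → ⊥) →
              Step ŵ w (T , U) e (T , U ∖ e)
    rejLarge : ∀ {T U e} f → e ∉ T → IsEmax ŵ T (U ∖ e) e f → ŵ f < w e →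
              Step ŵ w (T , U) e (T , U ∖ e)

  data Steps (ŵ w : F m → ℚ) : Subset m × Subset m → List (F m) → Subset m × Subset m → Set where
    done : ∀ {s} → Steps ŵ w s [] s
    next : ∀ {s s' s'' e σ} → Step ŵ w s e s' → Steps ŵ w s' σ s'' → Steps ŵ w s (e ∷ σ) s''

  Run : (ŵ w : F m → ℚ) → Subset m → List (F m) → Subset m → Set
  Run ŵ w T₀ σ T = Σ[ U ∈ Subset m ] Steps ŵ w (T₀ , ⊤) σ (T , U)

  allEdges : List (F m)
  allEdges = VF.toList (λ e → e)

insertAll : {A : Set} → A → List A → List (List A)
insertAll x []       = (x ∷ []) ∷ []
insertAll x (y ∷ ys) = (x ∷ y ∷ ys) ∷ map (y ∷_) (insertAll x ys)

perms : {A : Set} → List A → List (List A)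
perms []       = [] ∷ []
perms (x ∷ xs) = concatMap (insertAll x) (perms xs)

record Instance : Set where
  field
    graph : Graph
  open Graph graph public
  field
    ŵ w   : F m → ℚ
    ŵ-pos : ∀ e → 0ℚ < ŵ e
    w-pos : ∀ e → 0ℚ < w e

  p : F m → ℚ
  p e = ∣ w e - ŵ e ∣

  η : ℚ
  η = sumℚ graph (take (n ∸ 1) (reverse (MS.sort ≤-decTotalOrder (map p (allEdges graph)))))

{-# OPTIONS --safe #-}
module Submission where

-- Take the triangle with edges e₀₁, e₁₂, e₀₂, predictions ŵ = (1, 1, y) and true
-- weights w = (1, 1 + t, y), where 1 < y ≤ 1 + t. The predicted MST {e₀₁, e₁₂} is
-- unique, and GFtP never swaps: the only non-tree edge e₀₂ arrives with true weight
-- y, above the prediction 1 of every edge it could replace. So every arrival order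
-- costs 2 + t, while Opt = 1 + y (the tree {e₀₁, e₀₂}) and η = t. Taking y − 1 small
-- against (1 − r) t gives 2 + t ≥ (1 + y) + r t, i.e. ratio ≥ 1 + r ε. For ε = 0 the
-- same triangle with w = ŵ makes the bound trivial.

open import Defs
open import Data.Nat.Base using (zero; suc; _!)
open import Data.Integer.Base using (+_)
open import Data.Rational.Base
  using (ℚ; 0ℚ; 1ℚ; _+_; _*_; _-_; -_; _/_; _≤_; _<_; _⊓_; ∣_∣; positive; nonNegative)
import Data.Rational.Properties as ℚ
open import Data.Rational.Solver using (module +-*-Solver)
open import Data.List.Base using (List; []; _∷_; map; take; reverse; merge)
open import Data.List.Properties using (map-cong-local)
import Data.List.Relation.Unary.All as All
open import Data.List.Membership.Propositional using (_∈_)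
import Data.List.Sort.MergeSort.Base as MergeSort
open import Data.Fin.Base using (Fin; zero; suc)
open import Data.Fin.Properties using (_≟_)
open import Data.Fin.Subset using (Subset; ⊤; _∉_) renaming (_-_ to _∖_; _∈_ to _∈ₛ_)
open import Data.Fin.Subset.Properties using (∈⊤)
open import Data.Vec.Base using ([]; _∷_; here; there)
open import Data.Bool.Base using (true; false; if_then_else_)
open import Data.Product.Base using (Σ-syntax; ∃-syntax; _×_; _,_; proj₁; proj₂)
open import Data.Sum.Base using (_⊎_; inj₁; inj₂)
open import Data.Empty using (⊥; ⊥-elim)
open import Data.Unit.Base using (tt)
open import Function.Base using (_∘_; case_of_)
open import Relation.Binary.Definitions using (tri<; tri≈; tri>)
open import Relation.Binary.PropositionalEquality
  using (_≡_; _≢_; refl; sym; trans; cong; cong₂; subst; subst₂)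
open import Relation.Nullary using (¬_; does; yes; no)
open import Relation.Nullary.Decidable using (dec-true; toWitness)

open +-*-Solver

<⇒≱ : ∀ {p q} → p < q → ¬ q ≤ p
<⇒≱ p<q q≤p = ℚ.<-irrefl refl (ℚ.<-≤-trans p<q q≤p)

≤-by-difference : ∀ {p q} d → q ≡ p + d → 0ℚ ≤ d → p ≤ q
≤-by-difference {p} d q≡p+d 0≤d = subst₂ _≤_ (ℚ.+-identityʳ p) (sym q≡p+d) (ℚ.+-monoʳ-≤ p 0≤d)

0≤-difference : ∀ {p q} → p ≤ q → 0ℚ ≤ q - p
0≤-difference {p} {q} p≤q = subst (_≤ q - p) (ℚ.+-inverseʳ p) (ℚ.+-monoˡ-≤ (- p) p≤q)

0<-difference : ∀ {p q} → p < q → 0ℚ < q - p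
0<-difference {p} {q} p<q = subst (_< q - p) (ℚ.+-inverseʳ p) (ℚ.+-monoˡ-< (- p) p<q)

0≤* : ∀ {p q} → 0ℚ ≤ p → 0ℚ ≤ q → 0ℚ ≤ p * q
0≤* {p} {q} 0≤p 0≤q = subst (_≤ p * q) (ℚ.*-zeroʳ p) (ℚ.*-monoˡ-≤-nonNeg p {{nonNegative 0≤p}} 0≤q)

0<* : ∀ {p q} → 0ℚ < p → 0ℚ < q → 0ℚ < p * q
0<* {p} {q} 0<p 0<q = ℚ.positive⁻¹ (p * q) {{ℚ.pos*pos⇒pos p {{positive 0<p}} q {{positive 0<q}}}}

0<1 : 0ℚ < 1ℚ
0<1 = toWitness {a? = 0ℚ ℚ.<? 1ℚ} tt

Joins-sym : ∀ {n} {p : Fin n × Fin n} {u v} → Joins p u v → Joins p v u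
Joins-sym (inj₁ eq) = inj₂ eq
Joins-sym (inj₂ eq) = inj₁ eq

module _ {n m} {ends : Fin m → Fin n × Fin n} {S : Subset m} where

  edge : ∀ {u v} e → e ∈ₛ S → Joins (ends e) u v → Reachable ends S u v
  edge e e∈S j = step e e∈S j here

  reachable-trans : ∀ {u x v} → Reachable ends S u x → Reachable ends S x v → Reachable ends S u v
  reachable-trans here              r = r
  reachable-trans (step e e∈S j r′) r = step e e∈S j (reachable-trans r′ r)

  reachable-sym : ∀ {u v} → Reachable ends S u v → Reachable ends S v u
  reachable-sym here              = here
  reachable-sym (step e e∈S j r) = reachable-trans (reachable-sym r) (edge e e∈S (Joins-sym j))

  connected-from : ∀ x → (∀ v → Reachable ends S x v) → ∀ u v → Reachable ends S u v
  connected-from x reach u v = reachable-trans (reachable-sym (reach u)) (reach v)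

  isolated-reaches-only-itself : ∀ {x v} → (∀ e → e ∈ₛ S → ∀ y → ¬ Joins (ends e) x y) →
                                 Reachable ends S x v → x ≡ v
  isolated-reaches-only-itself isolated here             = refl
  isolated-reaches-only-itself isolated (step e e∈S j _) = ⊥-elim (isolated e e∈S _ j)

three-not-in-pair : ∀ {A : Set} {p q a b c : A} → a ≢ b → b ≢ c → a ≢ c →
                    a ≡ p ⊎ a ≡ q → b ≡ p ⊎ b ≡ q → c ≡ p ⊎ c ≡ q → ⊥
three-not-in-pair a≢b _   _   (inj₁ refl) (inj₁ refl) _           = a≢b refl
three-not-in-pair a≢b _   _   (inj₂ refl) (inj₂ refl) _           = a≢b refl
three-not-in-pair _   _   a≢c (inj₁ refl) (inj₂ _)    (inj₁ refl) = a≢c refl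
three-not-in-pair _   _   a≢c (inj₂ refl) (inj₁ _)    (inj₂ refl) = a≢c refl
three-not-in-pair _   b≢c _   (inj₁ _)    (inj₂ refl) (inj₂ refl) = b≢c refl
three-not-in-pair _   b≢c _   (inj₂ _)    (inj₁ refl) (inj₁ refl) = b≢c refl

module _ (G : Graph) where
  open Graph G

  joins-same-pair⇒≡ : ∀ e f {u v} → Joins (ends e) u v → Joins (ends f) u v → e ≡ f
  joins-same-pair⇒≡ e f (inj₁ refl) j = simple e f j
  joins-same-pair⇒≡ e f (inj₂ refl) j = simple e f (Joins-sym j)

  -- A cycle of length 1 is a loop, one of length 2 a pair of parallel edges,
  -- and a longer one has three distinct edges.
  acyclic-⊆-pair : ∀ {S} p q → (∀ e → e ∈ₛ S → e ≡ p ⊎ e ≡ q) → Acyclic G S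
  acyclic-⊆-pair {S} p q S⊆pq C = no-cycle k vs es (λ i≢j → i≢j ∘ esInj) esIn esJ
    where
    open Cycle C
    no-cycle : ∀ k (vs : Fin (suc k) → Fin n) (es : Fin (suc k) → Fin m) →
               (∀ {i j} → i ≢ j → es i ≢ es j) → (∀ i → es i ∈ₛ S) →
               (∀ i → Joins (ends (es i)) (vs i) (vs (cyc i))) → ⊥
    no-cycle zero vs es _ _ J = noLoop (es zero) (loop (J zero))
      where
      loop : ∀ {p : Fin n × Fin n} {u} → Joins p u u → proj₁ p ≡ proj₂ p
      loop (inj₁ refl) = refl
      loop (inj₂ refl) = refl
    no-cycle (suc zero) vs es distinct _ J =
      distinct {zero} {suc zero} (λ ()) (joins-same-pair⇒≡ _ _ (J zero) (Joins-sym (J (suc zero))))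
    no-cycle (suc (suc k)) vs es distinct es∈S _ =
      three-not-in-pair (distinct {zero} {suc zero} (λ ())) (distinct {suc zero} {suc (suc zero)} (λ ()))
                        (distinct {zero} {suc (suc zero)} (λ ()))
                        (S⊆pq _ (es∈S zero)) (S⊆pq _ (es∈S (suc zero))) (S⊆pq _ (es∈S (suc (suc zero))))

x∉p∖x : ∀ {k} (p : Subset k) x → x ∉ p ∖ x
x∉p∖x (_ ∷ p) zero    ()
x∉p∖x (_ ∷ p) (suc x) (there x∈p∖x) = x∉p∖x p x x∈p∖x

module _ (G : Graph) {ŵ w : Fin (Graph.m G) → ℚ} where
  open Graph G

  runs-with-fixed-tree : ∀ {T} → (∀ U e → Step G ŵ w (T , U) e (T , U ∖ e)) →
                         ∀ U σ → ∃[ U′ ] Steps G ŵ w (T , U) σ (T , U′)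
  runs-with-fixed-tree stay U []      = U , done
  runs-with-fixed-tree stay U (e ∷ σ) =
    let U′ , steps = runs-with-fixed-tree stay (U ∖ e) σ in U′ , next (stay U e) steps

  -- The edge f a swap removes is unseen, hence differs from e, and the swap needs w e ≤ ŵ f.
  tree-never-changes : ∀ {T U σ T′ U′} → (∀ e f → e ∉ T → f ≢ e → ŵ f < w e) →
                       Steps G ŵ w (T , U) σ (T′ , U′) → T′ ≡ T
  tree-never-changes heavier done                        = refl
  tree-never-changes heavier (next (inTree _) steps)     = tree-never-changes heavier steps
  tree-never-changes heavier (next (rejEmpty _ _) steps) = tree-never-changes heavier steps
  tree-never-changes heavier (next (rejLarge _ _ _ _) steps) = tree-never-changes heavier steps
  tree-never-changes {U = U} heavier (next (swap {e = e} f e∉T (f∈U∖e , _) we≤ŵf) _) =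
    ⊥-elim (<⇒≱ (heavier e f e∉T (λ { refl → x∉p∖x U f f∈U∖e })) we≤ŵf)

pattern v₀ = zero
pattern v₁ = suc zero
pattern v₂ = suc (suc zero)

pattern e₀₁ = zero
pattern e₁₂ = suc zero
pattern e₀₂ = suc (suc zero)

triangle-ends : Fin 3 → Fin 3 × Fin 3
triangle-ends e₀₁ = v₀ , v₁
triangle-ends e₁₂ = v₁ , v₂
triangle-ends e₀₂ = v₀ , v₂

triangle-noLoop : ∀ e → proj₁ (triangle-ends e) ≢ proj₂ (triangle-ends e)
triangle-noLoop e₀₁ ()
triangle-noLoop e₁₂ ()
triangle-noLoop e₀₂ ()

triangle-simple : ∀ e f → Joins (triangle-ends f) (proj₁ (triangle-ends e)) (proj₂ (triangle-ends e)) → e ≡ f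
triangle-simple e₀₁ e₀₁ _        = refl
triangle-simple e₁₂ e₁₂ _        = refl
triangle-simple e₀₂ e₀₂ _        = refl
triangle-simple e₀₁ e₁₂ (inj₁ ())
triangle-simple e₀₁ e₁₂ (inj₂ ())
triangle-simple e₀₁ e₀₂ (inj₁ ())
triangle-simple e₀₁ e₀₂ (inj₂ ())
triangle-simple e₁₂ e₀₁ (inj₁ ())
triangle-simple e₁₂ e₀₁ (inj₂ ())
triangle-simple e₁₂ e₀₂ (inj₁ ())
triangle-simple e₁₂ e₀₂ (inj₂ ())
triangle-simple e₀₂ e₀₁ (inj₁ ())
triangle-simple e₀₂ e₀₁ (inj₂ ())
triangle-simple e₀₂ e₁₂ (inj₁ ())
triangle-simple e₀₂ e₁₂ (inj₂ ())

triangle : Graph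
triangle = record
  { n = 3 ; m = 3 ; ends = triangle-ends ; noLoop = triangle-noLoop ; simple = triangle-simple
  ; connected = connected-from v₀ λ { v₀ → here
                                    ; v₁ → edge e₀₁ ∈⊤ (inj₁ refl)
                                    ; v₂ → edge e₀₂ ∈⊤ (inj₁ refl) } }

triangle-cycle : Cycle triangle-ends ⊤
triangle-cycle = record
  { k = 2 ; vs = λ i → i ; es = λ i → i ; vsInj = λ eq → eq ; esInj = λ eq → eq ; esIn = λ _ → ∈⊤ ; esJ = joins }
  where
  joins : ∀ i → Joins (triangle-ends i) i (cyc i)
  joins e₀₁ = inj₁ refl
  joins e₁₂ = inj₁ refl
  joins e₀₂ = inj₂ refl

⊤∖-spanningTree : ∀ e → IsSpanningTree triangle (⊤ ∖ e)
⊤∖-spanningTree e₀₁ =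
  connected-from v₀ (λ { v₀ → here
                       ; v₁ → step e₀₂ (there (there here)) (inj₁ refl) (edge e₁₂ (there here) (inj₂ refl))
                       ; v₂ → edge e₀₂ (there (there here)) (inj₁ refl) }) ,
  acyclic-⊆-pair triangle e₁₂ e₀₂ λ { e₁₂ _ → inj₁ refl ; e₀₂ _ → inj₂ refl ; e₀₁ () }
⊤∖-spanningTree e₁₂ =
  connected-from v₀ (λ { v₀ → here
                       ; v₁ → edge e₀₁ here (inj₁ refl)
                       ; v₂ → edge e₀₂ (there (there here)) (inj₁ refl) }) ,
  acyclic-⊆-pair triangle e₀₁ e₀₂ λ { e₀₁ _ → inj₁ refl ; e₀₂ _ → inj₂ refl ; e₁₂ (there ()) }
⊤∖-spanningTree e₀₂ =
  connected-from v₀ (λ { v₀ → here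
                       ; v₁ → edge e₀₁ here (inj₁ refl)
                       ; v₂ → step e₀₁ here (inj₁ refl) (edge e₁₂ (there here) (inj₁ refl)) }) ,
  acyclic-⊆-pair triangle e₀₁ e₁₂ λ { e₀₁ _ → inj₁ refl ; e₁₂ _ → inj₂ refl ; e₀₂ (there (there ())) }

spanningTree⇒⊤∖ : ∀ S → IsSpanningTree triangle S → ∃[ e ] S ≡ ⊤ ∖ e
spanningTree⇒⊤∖ (false ∷ true  ∷ true  ∷ []) _ = e₀₁ , refl
spanningTree⇒⊤∖ (true  ∷ false ∷ true  ∷ []) _ = e₁₂ , refl
spanningTree⇒⊤∖ (true  ∷ true  ∷ false ∷ []) _ = e₀₂ , refl
spanningTree⇒⊤∖ (true  ∷ true  ∷ true  ∷ []) (_ , acyclic) = ⊥-elim (acyclic triangle-cycle)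
spanningTree⇒⊤∖ (false ∷ false ∷ false ∷ []) (connected , _) =
  case isolated-reaches-only-itself (λ { e₀₁ () ; e₁₂ (there ()) ; e₀₂ (there (there ())) }) (connected v₀ v₁) of λ ()
spanningTree⇒⊤∖ (true  ∷ false ∷ false ∷ []) (connected , _) =
  case isolated-reaches-only-itself (λ { e₀₁ _ _ (inj₁ ()) ; e₀₁ _ _ (inj₂ ())
                                       ; e₁₂ (there ()) ; e₀₂ (there (there ())) }) (connected v₂ v₀) of λ ()
spanningTree⇒⊤∖ (false ∷ true  ∷ false ∷ []) (connected , _) =
  case isolated-reaches-only-itself (λ { e₀₁ () ; e₁₂ _ _ (inj₁ ()) ; e₁₂ _ _ (inj₂ ())
                                       ; e₀₂ (there (there ())) }) (connected v₀ v₁) of λ ()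
spanningTree⇒⊤∖ (false ∷ false ∷ true  ∷ []) (connected , _) =
  case isolated-reaches-only-itself (λ { e₀₁ () ; e₁₂ (there ())
                                       ; e₀₂ _ _ (inj₁ ()) ; e₀₂ _ _ (inj₂ ()) }) (connected v₁ v₀) of λ ()

weight-⊤∖ : ∀ c e → weight triangle c (⊤ ∖ e) ≡ weight triangle c ⊤ - c e
weight-⊤∖ c e₀₁ = solve 3 (λ x y z → con 0ℚ :+ (y :+ (z :+ con 0ℚ)) := (x :+ (y :+ (z :+ con 0ℚ))) :- x) refl (c e₀₁) (c e₁₂) (c e₀₂)
weight-⊤∖ c e₁₂ = solve 3 (λ x y z → x :+ (con 0ℚ :+ (z :+ con 0ℚ)) := (x :+ (y :+ (z :+ con 0ℚ))) :- y) refl (c e₀₁) (c e₁₂) (c e₀₂)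
weight-⊤∖ c e₀₂ = solve 3 (λ x y z → x :+ (y :+ (con 0ℚ :+ con 0ℚ)) := (x :+ (y :+ (z :+ con 0ℚ))) :- z) refl (c e₀₁) (c e₁₂) (c e₀₂)

weight-⊤∖-antitone : ∀ c {e f} → c f ≤ c e → weight triangle c (⊤ ∖ e) ≤ weight triangle c (⊤ ∖ f)
weight-⊤∖-antitone c {e} {f} cf≤ce =
  subst₂ _≤_ (sym (weight-⊤∖ c e)) (sym (weight-⊤∖ c f)) (ℚ.+-monoʳ-≤ (weight triangle c ⊤) (ℚ.neg-antimono-≤ cf≤ce))

weight-⊤∖-antitone-< : ∀ c {e f} → c f < c e → weight triangle c (⊤ ∖ e) < weight triangle c (⊤ ∖ f)
weight-⊤∖-antitone-< c {e} {f} cf<ce =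
  subst₂ _<_ (sym (weight-⊤∖ c e)) (sym (weight-⊤∖ c f)) (ℚ.+-monoʳ-< (weight triangle c ⊤) (ℚ.neg-antimono-< cf<ce))

minST-⊤∖-heaviest : ∀ c e → (∀ f → c f ≤ c e) → IsMinST triangle c (⊤ ∖ e)
minST-⊤∖-heaviest c e heaviest = ⊤∖-spanningTree e , λ T T-spanning →
  let f , T≡⊤∖f = spanningTree⇒⊤∖ T T-spanning in
  subst (λ S → weight triangle c (⊤ ∖ e) ≤ weight triangle c S) (sym T≡⊤∖f) (weight-⊤∖-antitone c (heaviest f))

minST-⊤∖-unique : ∀ c e → (∀ f → f ≢ e → c f < c e) → ∀ T → IsMinST triangle c T → T ≡ ⊤ ∖ e
minST-⊤∖-unique c e heaviest T (T-spanning , T-minimal) with spanningTree⇒⊤∖ T T-spanning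
... | f , refl with f ≟ e
...   | yes refl = refl
...   | no f≢e   = ⊥-elim (<⇒≱ (weight-⊤∖-antitone-< c (heaviest f f≢e)) (T-minimal (⊤ ∖ e) (⊤∖-spanningTree e)))

predicted : ℚ → Fin 3 → ℚ
predicted y e₀₁ = 1ℚ
predicted y e₁₂ = 1ℚ
predicted y e₀₂ = y

actual : ℚ → ℚ → Fin 3 → ℚ
actual t y e₀₁ = 1ℚ
actual t y e₁₂ = 1ℚ + t
actual t y e₀₂ = y

lower-bound-instance : ∀ t y → 0ℚ ≤ t → 1ℚ < y → Instance
lower-bound-instance t y 0≤t 1<y = record
  { graph = triangle ; ŵ = predicted y ; w = actual t y ; ŵ-pos = ŵ-pos ; w-pos = w-pos }
  where
  0<y : 0ℚ < y
  0<y = ℚ.<-trans 0<1 1<y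
  ŵ-pos : ∀ e → 0ℚ < predicted y e
  ŵ-pos e₀₁ = 0<1
  ŵ-pos e₁₂ = 0<1
  ŵ-pos e₀₂ = 0<y
  w-pos : ∀ e → 0ℚ < actual t y e
  w-pos e₀₁ = 0<1
  w-pos e₁₂ = ℚ.+-mono-<-≤ 0<1 0≤t
  w-pos e₀₂ = 0<y

sum-of-two-largest : ∀ {t} → 0ℚ ≤ t →
  sumℚ triangle (take 2 (reverse (MergeSort.sort ℚ.≤-decTotalOrder (0ℚ ∷ t ∷ 0ℚ ∷ [])))) ≡ t
sum-of-two-largest {t} 0≤t =
  -- sort unfolds to merge (merge [0] [t]) [0]; only the comparisons with t are left open.
  trans (cong (λ xs → sumℚ triangle (take 2 (reverse (merge ℚ._≤?_ xs (0ℚ ∷ []))))) 0-before-t)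
        (either-order (does (t ℚ.≤? 0ℚ)))
  where
  0-before-t : merge ℚ._≤?_ (0ℚ ∷ []) (t ∷ []) ≡ 0ℚ ∷ t ∷ []
  0-before-t = cong (λ b → if b then 0ℚ ∷ t ∷ [] else t ∷ 0ℚ ∷ []) (dec-true (0ℚ ℚ.≤? t) 0≤t)
  either-order : ∀ b → sumℚ triangle (take 2 (reverse (0ℚ ∷ (if b then t ∷ 0ℚ ∷ [] else 0ℚ ∷ t ∷ [])))) ≡ t
  either-order true  = trans (ℚ.+-identityˡ (t + 0ℚ)) (ℚ.+-identityʳ t)
  either-order false = ℚ.+-identityʳ t

η-lower-bound-instance : ∀ t y 0≤t 1<y → Instance.η (lower-bound-instance t y 0≤t 1<y) ≡ t
η-lower-bound-instance t y 0≤t 1<y =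
  trans (cong (λ ps → sumℚ triangle (take 2 (reverse (MergeSort.sort ℚ.≤-decTotalOrder (0ℚ ∷ ps))))) deviations)
        (sum-of-two-largest 0≤t)
  where
  deviations : ∣ (1ℚ + t) - 1ℚ ∣ ∷ ∣ y - y ∣ ∷ [] ≡ t ∷ 0ℚ ∷ []
  deviations = cong₂ (λ p q → p ∷ q ∷ [])
    (trans (cong ∣_∣ (solve 1 (λ t → (con 1ℚ :+ t) :- con 1ℚ := t) refl t)) (ℚ.0≤p⇒∣p∣≡p 0≤t))
    (cong ∣_∣ (ℚ.+-inverseʳ y))

module _ {y : ℚ} (1<y : 1ℚ < y) where

  predicted-heaviest : ∀ f → predicted y f ≤ y
  predicted-heaviest e₀₁ = ℚ.<⇒≤ 1<y
  predicted-heaviest e₁₂ = ℚ.<⇒≤ 1<y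
  predicted-heaviest e₀₂ = ℚ.≤-refl

  predicted-minST : IsMinST triangle (predicted y) (⊤ ∖ e₀₂)
  predicted-minST = minST-⊤∖-heaviest (predicted y) e₀₂ predicted-heaviest

  predicted-minST-unique : ∀ T → IsMinST triangle (predicted y) T → T ≡ ⊤ ∖ e₀₂
  predicted-minST-unique = minST-⊤∖-unique (predicted y) e₀₂ λ
    { e₀₁ _ → 1<y ; e₁₂ _ → 1<y ; e₀₂ e₀₂≢e₀₂ → ⊥-elim (e₀₂≢e₀₂ refl) }

module _ {t y : ℚ} (1<y : 1ℚ < y) where

  predicted-≤1-off-e₀₂ : ∀ U g → g ∈ₛ U ∖ e₀₂ → predicted y g ≤ 1ℚ
  predicted-≤1-off-e₀₂ U e₀₁ _ = ℚ.≤-refl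
  predicted-≤1-off-e₀₂ U e₁₂ _ = ℚ.≤-refl
  predicted-≤1-off-e₀₂ U e₀₂ e₀₂∈U∖e₀₂ = ⊥-elim (x∉p∖x U e₀₂ e₀₂∈U∖e₀₂)

  -- On arrival of e₀₂ the candidates e₀₁, e₁₂ are predicted at 1 < y = w e₀₂.
  gftp-rejects : ∀ U e → Step triangle (predicted y) (actual t y) (⊤ ∖ e₀₂ , U) e (⊤ ∖ e₀₂ , U ∖ e)
  gftp-rejects U e₀₁ = inTree here
  gftp-rejects U e₁₂ = inTree (there here)
  gftp-rejects U@(true ∷ _ ∷ _ ∷ []) e₀₂ =
    rejLarge e₀₁ (x∉p∖x ⊤ e₀₂) (here , (triangle-cycle , e₀₁ , refl) , λ g g∈ _ → predicted-≤1-off-e₀₂ U g g∈) 1<y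
  gftp-rejects U@(false ∷ true ∷ _ ∷ []) e₀₂ =
    rejLarge e₁₂ (x∉p∖x ⊤ e₀₂) (there here , (triangle-cycle , e₁₂ , refl) , λ g g∈ _ → predicted-≤1-off-e₀₂ U g g∈) 1<y
  gftp-rejects (false ∷ false ∷ _ ∷ []) e₀₂ =
    rejEmpty (x∉p∖x ⊤ e₀₂) λ { e₀₁ () ; e₁₂ (there ()) ; e₀₂ (there (there ())) }

  gftp-keeps-tree : ∀ {U σ T U′} →
    Steps triangle (predicted y) (actual t y) (⊤ ∖ e₀₂ , U) σ (T , U′) → T ≡ ⊤ ∖ e₀₂
  gftp-keeps-tree = tree-never-changes triangle heavier
    where
    heavier : ∀ e f → e ∉ ⊤ ∖ e₀₂ → f ≢ e → predicted y f < actual t y e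
    heavier e₀₁ _   e∉T _   = ⊥-elim (e∉T here)
    heavier e₁₂ _   e∉T _   = ⊥-elim (e∉T (there here))
    heavier e₀₂ e₀₁ _   _   = 1<y
    heavier e₀₂ e₁₂ _   _   = 1<y
    heavier e₀₂ e₀₂ _   f≢e = ⊥-elim (f≢e refl)

  gftp-runs : ∀ T₀ → IsMinST triangle (predicted y) T₀ → ∀ σ → σ ∈ perms (allEdges triangle) →
              ∃[ T ] Run triangle (predicted y) (actual t y) T₀ σ T
  gftp-runs T₀ T₀-min σ _ with predicted-minST-unique 1<y T₀ T₀-min
  ... | refl = ⊤ ∖ e₀₂ , runs-with-fixed-tree triangle gftp-rejects ⊤ σ

  gftp-total-cost-≥ : ∀ {X} → X ≤ weight triangle (actual t y) (⊤ ∖ e₀₂) →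
    ∀ T₀ → IsMinST triangle (predicted y) T₀ → (out : List (Fin 3) → Subset 3) →
    (∀ σ → σ ∈ perms (allEdges triangle) → Run triangle (predicted y) (actual t y) T₀ σ (out σ)) →
    (+ (3 !) / 1) * X ≤ sumℚ triangle (map (λ σ → weight triangle (actual t y) (out σ)) (perms (allEdges triangle)))
  gftp-total-cost-≥ {X} X≤ T₀ T₀-min out runs with predicted-minST-unique 1<y T₀ T₀-min
  ... | refl = subst ((+ (3 !) / 1) * X ≤_) (sym total-cost) (ℚ.*-monoˡ-≤-nonNeg (+ (3 !) / 1) X≤)
    where
    W = weight triangle (actual t y) (⊤ ∖ e₀₂)
    every-run-costs-W : map (λ σ → weight triangle (actual t y) (out σ)) (perms (allEdges triangle))
                      ≡ map (λ _ → W) (perms (allEdges triangle))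
    every-run-costs-W = map-cong-local (All.tabulate λ σ∈ →
      cong (weight triangle (actual t y)) (gftp-keeps-tree (proj₂ (runs _ σ∈))))
    total-cost : sumℚ triangle (map (λ σ → weight triangle (actual t y) (out σ)) (perms (allEdges triangle)))
               ≡ (+ (3 !) / 1) * W
    total-cost = trans (cong (sumℚ triangle) every-run-costs-W)
      (solve 1 (λ x → x :+ (x :+ (x :+ (x :+ (x :+ (x :+ con 0ℚ))))) := con (+ (3 !) / 1) :* x) refl W)

weight-actual-⊤∖e₀₂ : ∀ t y → weight triangle (actual t y) (⊤ ∖ e₀₂) ≡ 1ℚ + (1ℚ + t)
weight-actual-⊤∖e₀₂ t y = solve 1 (λ t → con 1ℚ :+ ((con 1ℚ :+ t) :+ con 0ℚ) := con 1ℚ :+ (con 1ℚ :+ t)) refl t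

weight-actual-⊤∖e₁₂ : ∀ t y → weight triangle (actual t y) (⊤ ∖ e₁₂) ≡ 1ℚ + y
weight-actual-⊤∖e₁₂ t y = solve 1 (λ y → con 1ℚ :+ (con 0ℚ :+ (y :+ con 0ℚ)) := con 1ℚ :+ y) refl y

module _ {t y : ℚ} where

  actual-minST-⊤∖e₁₂ : 1ℚ < y → y ≤ 1ℚ + t → IsMinST triangle (actual t y) (⊤ ∖ e₁₂)
  actual-minST-⊤∖e₁₂ 1<y y≤1+t = minST-⊤∖-heaviest (actual t y) e₁₂ λ
    { e₀₁ → ℚ.<⇒≤ (ℚ.<-≤-trans 1<y y≤1+t) ; e₁₂ → ℚ.≤-refl ; e₀₂ → y≤1+t }

  actual-minST-⊤∖e₀₂ : 1ℚ < y → 1ℚ + t ≤ y → IsMinST triangle (actual t y) (⊤ ∖ e₀₂)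
  actual-minST-⊤∖e₀₂ 1<y 1+t≤y = minST-⊤∖-heaviest (actual t y) e₀₂ λ
    { e₀₁ → ℚ.<⇒≤ 1<y ; e₁₂ → 1+t≤y ; e₀₂ → ℚ.≤-refl }

record Parameters (ε r : ℚ) : Set where
  field
    t y      : ℚ
    0≤t      : 0ℚ ≤ t
    1<y      : 1ℚ < y
    y≤1+t    : y ≤ 1ℚ + t
    t≡ε[1+y] : t ≡ ε * (1ℚ + y)
    ratio    : (1ℚ + r * ε) * (1ℚ + y) ≤ 1ℚ + (1ℚ + t)

-- y = 1 + s ε with s = min(1, 1 - r); then 1 + t - y = ε((1 - s) + y) and
-- 2 + t - (1 + r ε)(1 + y) = ((1 - r) - s) t + s ε y.
parameters : ∀ {ε r} → 0ℚ < ε → r < 1ℚ → Parameters ε r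
parameters {ε} {r} 0<ε r<1 = record
  { t = t ; y = y ; 0≤t = 0≤t ; 1<y = ℚ.+-monoʳ-< 1ℚ 0<sε ; y≤1+t = y≤1+t ; t≡ε[1+y] = refl ; ratio = ratio }
  where
  s = 1ℚ ⊓ (1ℚ - r)
  0<s : 0ℚ < s
  0<s with ℚ.⊓-sel 1ℚ (1ℚ - r)
  ... | inj₁ s≡1   = subst (0ℚ <_) (sym s≡1) 0<1
  ... | inj₂ s≡1-r = subst (0ℚ <_) (sym s≡1-r) (0<-difference r<1)
  y = 1ℚ + s * ε
  t = ε * (1ℚ + y)
  0<sε : 0ℚ < s * ε
  0<sε = 0<* 0<s 0<ε
  0≤y : 0ℚ ≤ y
  0≤y = ℚ.+-mono-≤ (ℚ.<⇒≤ 0<1) (ℚ.<⇒≤ 0<sε)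
  0≤t : 0ℚ ≤ t
  0≤t = 0≤* (ℚ.<⇒≤ 0<ε) (ℚ.+-mono-≤ (ℚ.<⇒≤ 0<1) 0≤y)
  y≤1+t : y ≤ 1ℚ + t
  y≤1+t = ≤-by-difference (ε * ((1ℚ - s) + y))
    (solve 2 (λ e s → con 1ℚ :+ e :* (con 1ℚ :+ (con 1ℚ :+ s :* e))
                    := (con 1ℚ :+ s :* e) :+ e :* ((con 1ℚ :- s) :+ (con 1ℚ :+ s :* e))) refl ε s)
    (0≤* (ℚ.<⇒≤ 0<ε) (ℚ.+-mono-≤ (0≤-difference (ℚ.p⊓q≤p 1ℚ (1ℚ - r))) 0≤y))
  ratio : (1ℚ + r * ε) * (1ℚ + y) ≤ 1ℚ + (1ℚ + t)
  ratio = ≤-by-difference (((1ℚ - r) - s) * t + s * ε * y)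
    (solve 3 (λ e s r → let y = con 1ℚ :+ s :* e ; t = e :* (con 1ℚ :+ y) in
                con 1ℚ :+ (con 1ℚ :+ t) := (con 1ℚ :+ r :* e) :* (con 1ℚ :+ y) :+ (((con 1ℚ :- r) :- s) :* t :+ s :* e :* y))
           refl ε s r)
    (ℚ.+-mono-≤ (0≤* (0≤-difference (ℚ.p⊓q≤q 1ℚ (1ℚ - r))) 0≤t) (0≤* (ℚ.<⇒≤ 0<sε) 0≤y))

mainTheorem11 : (ε r : ℚ) → 0ℚ ≤ ε → r < 1ℚ →
  Σ[ I ∈ Instance ]
    (let open Instance I in
     Σ[ Tₒ ∈ Subset m ]
       IsMinST graph w Tₒ × 0ℚ < weight graph w Tₒ
       × η ≡ ε * weight graph w Tₒ
       × (Σ[ T̂ ∈ Subset m ] IsMinST graph ŵ T̂)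
       × (∀ T₀ → IsMinST graph ŵ T₀ → ∀ σ → σ ∈ perms (allEdges graph) →
            ∃[ T ] Run graph ŵ w T₀ σ T)
       × (∀ T₀ → IsMinST graph ŵ T₀ → (out : List (Fin m) → Subset m) →
            (∀ σ → σ ∈ perms (allEdges graph) → Run graph ŵ w T₀ σ (out σ)) →
            ((+ (m !)) / 1) * ((1ℚ + r * ε) * weight graph w Tₒ)
              ≤ sumℚ graph (map (λ σ → weight graph w (out σ)) (perms (allEdges graph)))))
mainTheorem11 ε r 0≤ε r<1 with ℚ.<-cmp 0ℚ ε
... | tri> _ _ ε<0 = ⊥-elim (<⇒≱ ε<0 0≤ε)
... | tri≈ _ refl _ =
  lower-bound-instance 0ℚ 2ℚ ℚ.≤-refl 1<2 , ⊤ ∖ e₀₂ , actual-minST-⊤∖e₀₂ {0ℚ} 1<2 (ℚ.<⇒≤ 1<2) ,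
  toWitness {a? = 0ℚ ℚ.<? W} tt , trans (η-lower-bound-instance 0ℚ 2ℚ ℚ.≤-refl 1<2) (sym (ℚ.*-zeroˡ W)) ,
  (⊤ ∖ e₀₂ , predicted-minST 1<2) , gftp-runs {0ℚ} 1<2 ,
  gftp-total-cost-≥ {0ℚ} 1<2 (subst (λ z → (1ℚ + z) * W ≤ W) (sym (ℚ.*-zeroʳ r)) ℚ.≤-refl)
  where
  2ℚ = 1ℚ + 1ℚ
  1<2 : 1ℚ < 2ℚ
  1<2 = toWitness {a? = 1ℚ ℚ.<? 2ℚ} tt
  W = weight triangle (actual 0ℚ 2ℚ) (⊤ ∖ e₀₂)
... | tri< 0<ε _ _ = let open Parameters (parameters 0<ε r<1) in
  lower-bound-instance t y 0≤t 1<y , ⊤ ∖ e₁₂ , actual-minST-⊤∖e₁₂ {t} 1<y y≤1+t ,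
  subst (0ℚ <_) (sym (weight-actual-⊤∖e₁₂ t y)) (ℚ.+-mono-< 0<1 (ℚ.<-trans 0<1 1<y)) ,
  trans (η-lower-bound-instance t y 0≤t 1<y) (trans t≡ε[1+y] (cong (ε *_) (sym (weight-actual-⊤∖e₁₂ t y)))) ,
  (⊤ ∖ e₀₂ , predicted-minST 1<y) , gftp-runs {t} 1<y ,
  gftp-total-cost-≥ {t} 1<y
    (subst₂ (λ a b → (1ℚ + r * ε) * a ≤ b) (sym (weight-actual-⊤∖e₁₂ t y)) (sym (weight-actual-⊤∖e₀₂ t y)) ratio)
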